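{- For all positive integers $m$ and $d$, letting $k=d\cdot 2^m$, there exist pairwise disjoint sets $I_1,\dots,I_k\subseteq[mk]$ with $|I_i|\le m$ and functions $f_i$ with values in $\{0,1\}$ such that $f\colon\{0,1\}^{mk}\to\{0,1\}$, $f(x)=\prod_{i=1}^k f_i(x_{I_i})$, satisfies \[ W_{1,d}[f]\ge (m/e^{3/2})^d. \]
   Context: For $x\in\{0,1\}^N$ and $I\subseteq[N]$, $x_I$ denotes the bits of $x$ indexed by $I$. For $f\colon\{0,1\}^N\to\mathbb{C}$ and $S\subseteq[N]$, $\chi_S(x)=(-1)^{\sum_{i\in S}x_i}$ and $\hat f_S=\mathbb{E}_x[f(x)\chi_S(x)]$ with $x$ uniform. $W_{1,d}[f]:=\sum_{|S|=d}|\hat f_S|$. -}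

module Defs where

open import Data.Bool using (Bool; true; false; if_then_else_)
open import Data.Nat as ℕ using (ℕ; zero; suc)

open import Data.Empty using (⊥)
open import Data.Nat.Properties using (_!≢0)
open import Data.Fin using (Fin; zero; suc)
open import Data.Fin.Subset using (Subset; _∈_; _∩_) renaming (∣_∣ to card)
open import Data.Vec using (Vec; []; _∷_; lookup)
open import Data.List using (List; []; _∷_; map; _++_; filter)
open import Data.Rational using (ℚ; 0ℚ; 1ℚ; ½; _+_; _*_; -_; ∣_∣; _/_; _≤_; _<_)
open import Data.Integer using (+_)
open import Data.Product using (Σ; ∃; _×_)
open import Relation.Nullary using (¬_)
open import Relation.Binary.PropositionalEquality using (_≡_)

-- all points of {0,1}^n (also used to enumerate all subsets of [n])
cube : (n : ℕ) → List (Vec Bool n)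
cube zero = [] ∷ []
cube (suc n) = map (false ∷_) (cube n) ++ map (true ∷_) (cube n)

sumℚ : List ℚ → ℚ
sumℚ [] = 0ℚ
sumℚ (q ∷ qs) = q + sumℚ qs

prodFin : (k : ℕ) → (Fin k → ℚ) → ℚ
prodFin zero g = 1ℚ
prodFin (suc k) g = g zero * prodFin k (λ i → g (suc i))

negOnePow : ℕ → ℚ
negOnePow zero = 1ℚ
negOnePow (suc n) = - negOnePow n

halfPow : ℕ → ℚ
halfPow zero = 1ℚ
halfPow (suc n) = ½ * halfPow n

powℚ : ℚ → ℕ → ℚ
powℚ q zero = 1ℚ
powℚ q (suc n) = q * powℚ q n

boolℚ : Bool → ℚ
boolℚ true = 1ℚ
boolℚ false = 0ℚ

χ : {n : ℕ} → Subset n → Vec Bool n → ℚ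
χ S x = negOnePow (card (S ∩ x))

fourier : (n : ℕ) → (Vec Bool n → ℚ) → Subset n → ℚ
fourier n f S = halfPow n * sumℚ (map (λ x → f x * χ S x) (cube n))

W1 : (n d : ℕ) → (Vec Bool n → ℚ) → ℚ
W1 n d f = sumℚ (map (λ S → ∣ fourier n f S ∣) (filter (λ S → card S ℕ.≟ d) (cube n)))

Restr : {n : ℕ} → Subset n → Set
Restr {n} I = (j : Fin n) → j ∈ I → Bool

restrict : {n : ℕ} → Vec Bool n → (I : Subset n) → Restr I
restrict x I j _ = lookup x j

Disjoint : {n : ℕ} → Subset n → Subset n → Set
Disjoint {n} I J = (j : Fin n) → j ∈ I → j ∈ J → ⊥

expPartial : ℚ → ℕ → ℚ
expPartial x zero = 0ℚ
expPartial x (suc n) = expPartial x n + powℚ x n * ((+ 1 / (n ℕ.!)) {{n !≢0}})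

ℕtoℚ : ℕ → ℚ
ℕtoℚ n = + n / 1

-- The real inequality  W ≥ (m / e^{3/2})^d  for a rational W ≥ 0, expressed as
--   W² · e^{3d} ≥ m^{2d},  with e^{3d} = sup_n expPartial (3d) n,
-- i.e. for every rational ε > 0 some partial sum gives W² · P_n + ε ≥ m^{2d}.
BoundHolds : (m d : ℕ) → ℚ → Set
BoundHolds m d W =
  (ε : ℚ) → 0ℚ < ε →
  ∃ λ n → powℚ (ℕtoℚ m) (2 ℕ.* d) ≤ W * W * expPartial (ℕtoℚ (3 ℕ.* d)) n + ε

module Submission where

open import Algebra.Bundles using (CommutativeRing)
open import Data.Bool using (Bool; true; false; not; _∧_)
open import Data.Fin using (Fin; zero; suc; combine; _↑ˡ_; _↑ʳ_)
open import Data.Fin.Subset using (Subset; _∈_; _∩_; ⊤; ⊥) renaming (∣_∣ to card)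
open import Data.Fin.Subset.Properties using (∉⊥; ∈⊤; ∣⊤∣≡n; ∣⊥∣≡0; ∩-identityʳ)
import Data.Integer as ℤ
import Data.Integer.Tactic.RingSolver as ℤ-Solver
open import Data.List using (List; []; _∷_; map; _++_; filter; length)
import Data.List.Properties as List
open import Data.List.Relation.Unary.All as All using (All; []; _∷_)
open import Data.List.Relation.Unary.All.Properties using (all-filter)
open import Data.Nat as ℕ using (ℕ; zero; suc; z≤n; s≤s; _!)
import Data.Nat.Properties as ℕₚ
import Data.Nat.Tactic.RingSolver as ℕ-Solver
open import Data.Product using (Σ; ∃; _×_; _,_)
open import Data.Rational
  using (ℚ; 0ℚ; 1ℚ; ½; _+_; _*_; -_; _-_; ∣_∣; _/_; _≤_; toℚᵘ; *≤*; nonNegative)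
open import Data.Rational.Properties
import Data.Rational.Unnormalised as ℚᵘ
import Data.Rational.Unnormalised.Properties as ℚᵘₚ
open import Data.Vec as Vec using (Vec; []; _∷_; here; there)
import Data.Vec.Properties as Vec
open import Function using (_∘_)
open import Level using (0ℓ)
open import Relation.Binary.PropositionalEquality
  using (_≡_; _≢_; refl; sym; trans; cong; cong₂; subst; module ≡-Reasoning)
open import Relation.Nullary.Decidable.Core using (dec⇒maybe; does)
open import Relation.Unary using (Pred; Decidable)
open import Tactic.RingSolver using (solve-∀)
open import Tactic.RingSolver.Core.AlmostCommutativeRing
  using (AlmostCommutativeRing; fromCommutativeRing)

open import Defs
open import Algebra.Properties.CommutativeSemigroup
  (CommutativeRing.*-commutativeSemigroup +-*-commutativeRing)
  using (interchange; xy∙z≈xz∙y; xy∙z≈x∙zy)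
open import Algebra.Properties.CommutativeSemigroup ℕₚ.*-commutativeSemigroup
  using () renaming (interchange to ℕ-interchange; x∙yz≈y∙xz to ℕ-x∙yz≈y∙xz; x∙yz≈yx∙z to ℕ-x∙yz≈yx∙z)

-- Let g = ¬AND on m bits and q = 2^-m.  Then ĝ_∅ = 1 - q and |ĝ_T| = q for T ≠ ∅, so with
-- ρ = q / (1 - q) = 1 / (2^m - 1) every coefficient satisfies |ĝ_T| ≥ (1 - q) ρ^|T|.  Such
-- bounds multiply over functions of disjoint blocks of variables, so the product f of k
-- copies of g has |f̂_S| ≥ (1 - q)^k ρ^|S| and W_{1,d}[f] ≥ C(mk, d) (1 - q)^k ρ^d.  With
-- k = d 2^m we have C(mk, d) ≥ (mk / d)^d = (2^m m)^d, hence W_{1,d}[f] ≥ m^d (1 - q)^(k - d),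
-- and (1 - q)^-(k - d) = (1 + ρ)^(d (2^m - 1)) ≤ e^d.  The exponential enters only through its
-- partial sums, via (1 + y)^L ≤ Σ_{j ≤ L} (L y)^j / j!, proved by induction on L from
-- (j + 1)^(n + 1) ≥ j^(n + 1) + (n + 1) j^n.

ℚ-ring : AlmostCommutativeRing 0ℓ 0ℓ
ℚ-ring = fromCommutativeRing +-*-commutativeRing (λ x → dec⇒maybe (0ℚ ≟ x))

0≤1 : 0ℚ ≤ 1ℚ
0≤1 = *≤* (ℤ.+≤+ z≤n)

0≤½ : 0ℚ ≤ ½
0≤½ = *≤* (ℤ.+≤+ z≤n)

p≤p+q : ∀ {p q} → 0ℚ ≤ q → p ≤ p + q
p≤p+q {p} 0≤q = ≤-trans (≤-reflexive (sym (+-identityʳ p))) (+-monoʳ-≤ p 0≤q)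

*-nonNeg : ∀ {p q} → 0ℚ ≤ p → 0ℚ ≤ q → 0ℚ ≤ p * q
*-nonNeg {p} {q} 0≤p 0≤q =
  nonNegative⁻¹ (p * q) {{nonNeg*nonNeg⇒nonNeg p {{nonNegative 0≤p}} q {{nonNegative 0≤q}}}}

*-monoˡ-≤-0≤ : ∀ {p q} r → 0ℚ ≤ r → p ≤ q → r * p ≤ r * q
*-monoˡ-≤-0≤ r 0≤r = *-monoˡ-≤-nonNeg r {{nonNegative 0≤r}}

*-monoʳ-≤-0≤ : ∀ {p q} r → 0ℚ ≤ r → p ≤ q → p * r ≤ q * r
*-monoʳ-≤-0≤ r 0≤r = *-monoʳ-≤-nonNeg r {{nonNegative 0≤r}}

*-mono-≤-0≤ : ∀ {p q r s} → 0ℚ ≤ p → 0ℚ ≤ r → p ≤ q → r ≤ s → p * r ≤ q * s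
*-mono-≤-0≤ {q = q} {r} 0≤p 0≤r p≤q r≤s =
  ≤-trans (*-monoʳ-≤-0≤ r 0≤r p≤q) (*-monoˡ-≤-0≤ q (≤-trans 0≤p p≤q) r≤s)

fromℕ : ℕ → ℚ
fromℕ zero = 0ℚ
fromℕ (suc n) = 1ℚ + fromℕ n

fromℕ-+ : ∀ m n → fromℕ (m ℕ.+ n) ≡ fromℕ m + fromℕ n
fromℕ-+ zero n = sym (+-identityˡ (fromℕ n))
fromℕ-+ (suc m) n = trans (cong (1ℚ +_) (fromℕ-+ m n)) (sym (+-assoc 1ℚ (fromℕ m) (fromℕ n)))

fromℕ-* : ∀ m n → fromℕ (m ℕ.* n) ≡ fromℕ m * fromℕ n
fromℕ-* zero n = sym (*-zeroˡ (fromℕ n))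
fromℕ-* (suc m) n = begin
  fromℕ (n ℕ.+ m ℕ.* n)        ≡⟨ fromℕ-+ n (m ℕ.* n) ⟩
  fromℕ n + fromℕ (m ℕ.* n)    ≡⟨ cong (fromℕ n +_) (fromℕ-* m n) ⟩
  fromℕ n + fromℕ m * fromℕ n  ≡⟨ distrib (fromℕ m) (fromℕ n) ⟩
  (1ℚ + fromℕ m) * fromℕ n     ∎
  where
  open ≡-Reasoning
  distrib : ∀ a b → b + a * b ≡ (1ℚ + a) * b
  distrib = solve-∀ ℚ-ring

fromℕ-^ : ∀ m n → fromℕ (m ℕ.^ n) ≡ powℚ (fromℕ m) n
fromℕ-^ m zero = refl
fromℕ-^ m (suc n) = trans (fromℕ-* m (m ℕ.^ n)) (cong (fromℕ m *_) (fromℕ-^ m n))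

fromℕ-nonNeg : ∀ n → 0ℚ ≤ fromℕ n
fromℕ-nonNeg zero = ≤-refl
fromℕ-nonNeg (suc n) = +-mono-≤ 0≤1 (fromℕ-nonNeg n)

fromℕ-mono-≤ : ∀ {m n} → m ℕ.≤ n → fromℕ m ≤ fromℕ n
fromℕ-mono-≤ {n = n} z≤n = fromℕ-nonNeg n
fromℕ-mono-≤ (s≤s m≤n) = +-monoʳ-≤ 1ℚ (fromℕ-mono-≤ m≤n)

toℚᵘ-fromℕ : ∀ n → toℚᵘ (fromℕ n) ℚᵘ.≃ ℚᵘ.mkℚᵘ (ℤ.+ n) 0
toℚᵘ-fromℕ zero = ℚᵘₚ.≃-refl
toℚᵘ-fromℕ (suc n) = ℚᵘₚ.≃-trans (toℚᵘ-homo-+ 1ℚ (fromℕ n))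
  (ℚᵘₚ.≃-trans (ℚᵘₚ.+-congʳ (toℚᵘ 1ℚ) (toℚᵘ-fromℕ n)) (ℚᵘ.*≡* (cross-multiplied (ℤ.+ n))))
  where
  cross-multiplied : ∀ x →
    (ℤ.1ℤ ℤ.* ℤ.1ℤ ℤ.+ x ℤ.* ℤ.1ℤ) ℤ.* ℤ.1ℤ ≡ (ℤ.1ℤ ℤ.+ x) ℤ.* (ℤ.1ℤ ℤ.* ℤ.1ℤ)
  cross-multiplied = ℤ-Solver.solve-∀

ℕtoℚ≡fromℕ : ∀ n → ℕtoℚ n ≡ fromℕ n
ℕtoℚ≡fromℕ n = toℚᵘ-injective
  (ℚᵘₚ.≃-trans (toℚᵘ-fromℚᵘ (ℚᵘ.mkℚᵘ (ℤ.+ n) 0)) (ℚᵘₚ.≃-sym (toℚᵘ-fromℕ n)))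

1/n*n≡1 : ∀ n .{{_ : ℕ.NonZero n}} → (ℤ.+ 1 / n) * fromℕ n ≡ 1ℚ
1/n*n≡1 (suc n) = toℚᵘ-injective (ℚᵘₚ.≃-trans (toℚᵘ-homo-* (ℤ.+ 1 / suc n) (fromℕ (suc n)))
  (ℚᵘₚ.≃-trans (ℚᵘₚ.*-cong (toℚᵘ-fromℚᵘ (ℚᵘ.mkℚᵘ (ℤ.+ 1) n)) (toℚᵘ-fromℕ (suc n)))
    (ℚᵘ.*≡* (cong (λ x → ℤ.+ suc x) (cross-multiplied n)))))
  where
  cross-multiplied : ∀ n → (n ℕ.+ 0 ℕ.* suc n) ℕ.* 1 ≡ n ℕ.* 1 ℕ.+ 0 ℕ.* suc (n ℕ.* 1)
  cross-multiplied = ℕ-Solver.solve-∀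

powℚ-+ : ∀ x m n → powℚ x (m ℕ.+ n) ≡ powℚ x m * powℚ x n
powℚ-+ x zero n = sym (*-identityˡ (powℚ x n))
powℚ-+ x (suc m) n = trans (cong (x *_) (powℚ-+ x m n)) (sym (*-assoc x (powℚ x m) (powℚ x n)))

powℚ-distribʳ-* : ∀ x y n → powℚ (x * y) n ≡ powℚ x n * powℚ y n
powℚ-distribʳ-* x y zero = refl
powℚ-distribʳ-* x y (suc n) =
  trans (cong ((x * y) *_) (powℚ-distribʳ-* x y n)) (interchange x y (powℚ x n) (powℚ y n))

powℚ-1 : ∀ n → powℚ 1ℚ n ≡ 1ℚ
powℚ-1 zero = refl
powℚ-1 (suc n) = trans (*-identityˡ (powℚ 1ℚ n)) (powℚ-1 n)

powℚ-nonNeg : ∀ {x} n → 0ℚ ≤ x → 0ℚ ≤ powℚ x n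
powℚ-nonNeg zero 0≤x = 0≤1
powℚ-nonNeg (suc n) 0≤x = *-nonNeg 0≤x (powℚ-nonNeg n 0≤x)

powℚ-mono-≤ : ∀ {x y} n → 0ℚ ≤ x → x ≤ y → powℚ x n ≤ powℚ y n
powℚ-mono-≤ zero 0≤x x≤y = ≤-refl
powℚ-mono-≤ (suc n) 0≤x x≤y = *-mono-≤-0≤ 0≤x (powℚ-nonNeg n 0≤x) x≤y (powℚ-mono-≤ n 0≤x x≤y)

halfPow-+ : ∀ a b → halfPow (a ℕ.+ b) ≡ halfPow a * halfPow b
halfPow-+ zero b = sym (*-identityˡ (halfPow b))
halfPow-+ (suc a) b = trans (cong (½ *_) (halfPow-+ a b)) (sym (*-assoc ½ (halfPow a) (halfPow b)))

halfPow-nonNeg : ∀ m → 0ℚ ≤ halfPow m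
halfPow-nonNeg zero = 0≤1
halfPow-nonNeg (suc m) = *-nonNeg 0≤½ (halfPow-nonNeg m)

halfPow-≤-1 : ∀ m → halfPow m ≤ 1ℚ
halfPow-≤-1 zero = ≤-refl
halfPow-≤-1 (suc m) = begin
  ½ * halfPow m   ≤⟨ *-monoˡ-≤-0≤ ½ 0≤½ (halfPow-≤-1 m) ⟩
  ½ * 1ℚ          ≤⟨ *≤* (ℤ.+≤+ (s≤s z≤n)) ⟩
  1ℚ              ∎
  where open ≤-Reasoning

1-halfPow-nonNeg : ∀ m → 0ℚ ≤ 1ℚ - halfPow m
1-halfPow-nonNeg m = ≤-trans (≤-reflexive (sym (+-inverseʳ (halfPow m)))) (+-monoˡ-≤ (- halfPow m) (halfPow-≤-1 m))

halfPow*2^m≡1 : ∀ m → halfPow m * fromℕ (2 ℕ.^ m) ≡ 1ℚ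
halfPow*2^m≡1 zero = refl
halfPow*2^m≡1 (suc m) = begin
  (½ * halfPow m) * fromℕ (2 ℕ.* 2 ℕ.^ m)        ≡⟨ cong ((½ * halfPow m) *_) (fromℕ-* 2 (2 ℕ.^ m)) ⟩
  (½ * halfPow m) * (fromℕ 2 * fromℕ (2 ℕ.^ m))  ≡⟨ interchange ½ (halfPow m) (fromℕ 2) (fromℕ (2 ℕ.^ m)) ⟩
  (½ * fromℕ 2) * (halfPow m * fromℕ (2 ℕ.^ m))  ≡⟨ cong ((½ * fromℕ 2) *_) (halfPow*2^m≡1 m) ⟩
  1ℚ                                             ∎
  where open ≡-Reasoning

negOnePow-+ : ∀ a b → negOnePow (a ℕ.+ b) ≡ negOnePow a * negOnePow b
negOnePow-+ zero b = sym (*-identityˡ (negOnePow b))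
negOnePow-+ (suc a) b = trans (cong -_ (negOnePow-+ a b)) (neg-distribˡ-* (negOnePow a) (negOnePow b))

∣negOnePow∣≡1 : ∀ n → ∣ negOnePow n ∣ ≡ 1ℚ
∣negOnePow∣≡1 zero = refl
∣negOnePow∣≡1 (suc n) = trans (∣-p∣≡∣p∣ (negOnePow n)) (∣negOnePow∣≡1 n)

-- Partial sums of the exponential series

binomial-two-terms : ∀ n j → suc n ℕ.* j ℕ.^ n ℕ.+ j ℕ.^ suc n ℕ.≤ suc j ℕ.^ suc n
binomial-two-terms zero j = ℕₚ.≤-reflexive (identity j)
  where
  identity : ∀ j → 1 ℕ.* 1 ℕ.+ j ℕ.* 1 ≡ (1 ℕ.+ j) ℕ.* 1
  identity = ℕ-Solver.solve-∀
binomial-two-terms (suc n) j = begin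
  suc (suc n) ℕ.* (j ℕ.* P) ℕ.+ j ℕ.* (j ℕ.* P)                 ≤⟨ ℕₚ.m≤m+n _ (suc n ℕ.* P) ⟩
  suc (suc n) ℕ.* (j ℕ.* P) ℕ.+ j ℕ.* (j ℕ.* P) ℕ.+ suc n ℕ.* P ≡⟨ regroup (suc n) j P ⟩
  suc j ℕ.* (suc n ℕ.* P ℕ.+ j ℕ.* P)                           ≤⟨ ℕₚ.*-monoʳ-≤ (suc j) (binomial-two-terms n j) ⟩
  suc j ℕ.* suc j ℕ.^ suc n                                     ∎
  where
  open ℕₚ.≤-Reasoning
  P : ℕ
  P = j ℕ.^ n
  regroup : ∀ a j P → suc a ℕ.* (j ℕ.* P) ℕ.+ j ℕ.* (j ℕ.* P) ℕ.+ a ℕ.* P ≡ suc j ℕ.* (a ℕ.* P ℕ.+ j ℕ.* P)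
  regroup = ℕ-Solver.solve-∀

1/_! : ℕ → ℚ
1/ n ! = (ℤ.+ 1 / (n !)) {{n ℕₚ.!≢0}}

1/!-nonNeg : ∀ n → 0ℚ ≤ 1/ n !
1/!-nonNeg n = nonNegative⁻¹ _ {{normalize-nonNeg 1 (n !) {{n ℕₚ.!≢0}}}}

1/!-suc : ∀ n → 1/ n ! ≡ fromℕ (suc n) * 1/ suc n !
1/!-suc n = begin
  1/ n !                                              ≡⟨ sym (*-identityʳ (1/ n !)) ⟩
  1/ n ! * 1ℚ                                         ≡⟨ cong (1/ n ! *_) (sym (inverse (suc n))) ⟩
  1/ n ! * (1/ suc n ! * fromℕ (suc n ℕ.* n !))       ≡⟨ cong (λ t → 1/ n ! * (1/ suc n ! * t))
                                                           (fromℕ-* (suc n) (n !)) ⟩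
  1/ n ! * (1/ suc n ! * (fromℕ (suc n) * fromℕ (n !))) ≡⟨ regroup (1/ n !) (1/ suc n !) (fromℕ (suc n)) (fromℕ (n !)) ⟩
  (1/ n ! * fromℕ (n !)) * (fromℕ (suc n) * 1/ suc n !) ≡⟨ cong (_* (fromℕ (suc n) * 1/ suc n !)) (inverse n) ⟩
  1ℚ * (fromℕ (suc n) * 1/ suc n !)                     ≡⟨ *-identityˡ _ ⟩
  fromℕ (suc n) * 1/ suc n !                            ∎
  where
  open ≡-Reasoning
  inverse : ∀ n → 1/ n ! * fromℕ (n !) ≡ 1ℚ
  inverse n = 1/n*n≡1 (n !) {{n ℕₚ.!≢0}}
  regroup : ∀ a b c d → a * (b * (c * d)) ≡ (a * d) * (c * b)
  regroup = solve-∀ ℚ-ring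

expTerm : ℚ → ℕ → ℚ
expTerm x n = powℚ x n * 1/ n !

expTerm-nonNeg : ∀ {x} n → 0ℚ ≤ x → 0ℚ ≤ expTerm x n
expTerm-nonNeg n 0≤x = *-nonNeg (powℚ-nonNeg n 0≤x) (1/!-nonNeg n)

expPartial-nonNeg : ∀ {x} n → 0ℚ ≤ x → 0ℚ ≤ expPartial x n
expPartial-nonNeg zero 0≤x = ≤-refl
expPartial-nonNeg (suc n) 0≤x = +-mono-≤ (expPartial-nonNeg n 0≤x) (expTerm-nonNeg n 0≤x)

expPartial-monoˡ-≤ : ∀ {x x′} n → 0ℚ ≤ x → x ≤ x′ → expPartial x n ≤ expPartial x′ n
expPartial-monoˡ-≤ zero 0≤x x≤x′ = ≤-refl
expPartial-monoˡ-≤ (suc n) 0≤x x≤x′ =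
  +-mono-≤ (expPartial-monoˡ-≤ n 0≤x x≤x′) (*-monoʳ-≤-0≤ (1/ n !) (1/!-nonNeg n) (powℚ-mono-≤ n 0≤x x≤x′))

-- the coefficient of y^(n+1) grows from ((n+1) j^n + j^(n+1)) / (n+1)! to (j+1)^(n+1) / (n+1)!
expTerm-shift : ∀ {y} j n → 0ℚ ≤ y →
  y * expTerm (fromℕ j * y) n + expTerm (fromℕ j * y) (suc n) ≤ expTerm (fromℕ (suc j) * y) (suc n)
expTerm-shift {y} j n 0≤y = begin
  y * expTerm (J * y) n + expTerm (J * y) (suc n)
    ≡⟨ cong₂ (λ u v → y * (u * v) + (J * y) * u * I) (powℚ-distribʳ-* J y n) (1/!-suc n) ⟩
  y * ((Jⁿ * yⁿ) * (fromℕ (suc n) * I)) + (J * y) * (Jⁿ * yⁿ) * I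
    ≡⟨ regroup y Jⁿ yⁿ I (fromℕ (suc n)) J ⟩
  A * (fromℕ (suc n) * Jⁿ + J * Jⁿ)
    ≡⟨ cong (A *_) coefficients ⟨
  A * fromℕ (suc n ℕ.* j ℕ.^ n ℕ.+ j ℕ.^ suc n)
    ≤⟨ *-monoˡ-≤-0≤ A 0≤A (fromℕ-mono-≤ (binomial-two-terms n j)) ⟩
  A * fromℕ (suc j ℕ.^ suc n)
    ≡⟨ cong (A *_) (fromℕ-^ (suc j) (suc n)) ⟩
  A * powℚ (fromℕ (suc j)) (suc n)
    ≡⟨ rotate (powℚ y (suc n)) I (powℚ (fromℕ (suc j)) (suc n)) ⟩
  (powℚ (fromℕ (suc j)) (suc n) * powℚ y (suc n)) * I
    ≡⟨ cong (_* I) (powℚ-distribʳ-* (fromℕ (suc j)) y (suc n)) ⟨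
  expTerm (fromℕ (suc j) * y) (suc n) ∎
  where
  open ≤-Reasoning
  J Jⁿ yⁿ I A : ℚ
  J = fromℕ j
  Jⁿ = powℚ J n
  yⁿ = powℚ y n
  I = 1/ suc n !
  A = powℚ y (suc n) * I
  0≤A : 0ℚ ≤ A
  0≤A = expTerm-nonNeg (suc n) 0≤y
  coefficients : fromℕ (suc n ℕ.* j ℕ.^ n ℕ.+ j ℕ.^ suc n) ≡ fromℕ (suc n) * Jⁿ + J * Jⁿ
  coefficients = trans (fromℕ-+ (suc n ℕ.* j ℕ.^ n) (j ℕ.^ suc n))
    (cong₂ _+_ (trans (fromℕ-* (suc n) (j ℕ.^ n)) (cong (fromℕ (suc n) *_) (fromℕ-^ j n)))
               (fromℕ-^ j (suc n)))
  regroup : ∀ y a b i s c → y * ((a * b) * (s * i)) + (c * y) * (a * b) * i ≡ ((y * b) * i) * (s * a + c * a)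
  regroup = solve-∀ ℚ-ring
  rotate : ∀ a b c → (a * b) * c ≡ (c * a) * b
  rotate = solve-∀ ℚ-ring

expPartial-shift-remainder : ∀ {y} j n → 0ℚ ≤ y →
  (1ℚ + y) * expPartial (fromℕ j * y) (suc n) ≤ expPartial (fromℕ (suc j) * y) (suc n) + y * expTerm (fromℕ j * y) n
expPartial-shift-remainder {y} j zero 0≤y = ≤-reflexive (identity y (1/ 0 !))
  where
  identity : ∀ y i → (1ℚ + y) * (0ℚ + 1ℚ * i) ≡ (0ℚ + 1ℚ * i) + y * (1ℚ * i)
  identity = solve-∀ ℚ-ring
expPartial-shift-remainder {y} j (suc n) 0≤y = begin
  (1ℚ + y) * (E + T)                      ≡⟨ distrib y E T ⟩
  (1ℚ + y) * E + (T + y * T)              ≤⟨ +-monoˡ-≤ (T + y * T) (expPartial-shift-remainder j n 0≤y) ⟩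
  (E′ + y * expTerm X n) + (T + y * T)    ≡⟨ reassoc E′ (y * expTerm X n) T (y * T) ⟩
  (E′ + (y * expTerm X n + T)) + y * T    ≤⟨ +-monoˡ-≤ (y * T) (+-monoʳ-≤ E′ (expTerm-shift j n 0≤y)) ⟩
  (E′ + expTerm X′ (suc n)) + y * T       ∎
  where
  open ≤-Reasoning
  X X′ E E′ T : ℚ
  X = fromℕ j * y
  X′ = fromℕ (suc j) * y
  E = expPartial X (suc n)
  E′ = expPartial X′ (suc n)
  T = expTerm X (suc n)
  distrib : ∀ y e t → (1ℚ + y) * (e + t) ≡ (1ℚ + y) * e + (t + y * t)
  distrib = solve-∀ ℚ-ring
  reassoc : ∀ e a b c → (e + a) + (b + c) ≡ (e + (a + b)) + c
  reassoc = solve-∀ ℚ-ring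

expPartial-shift : ∀ {y} j n → 0ℚ ≤ y →
  (1ℚ + y) * expPartial (fromℕ j * y) (suc n) ≤ expPartial (fromℕ (suc j) * y) (suc (suc n))
expPartial-shift {y} j n 0≤y = ≤-trans (expPartial-shift-remainder j n 0≤y)
  (+-monoʳ-≤ (expPartial (fromℕ (suc j) * y) (suc n))
    (≤-trans (p≤p+q (expTerm-nonNeg (suc n) (*-nonNeg (fromℕ-nonNeg j) 0≤y))) (expTerm-shift j n 0≤y)))

1+y^n≤expPartial : ∀ {y} n → 0ℚ ≤ y → powℚ (1ℚ + y) n ≤ expPartial (fromℕ n * y) (suc n)
1+y^n≤expPartial zero 0≤y = ≤-refl
1+y^n≤expPartial {y} (suc n) 0≤y = ≤-trans
  (*-monoˡ-≤-0≤ (1ℚ + y) (+-mono-≤ 0≤1 0≤y) (1+y^n≤expPartial n 0≤y))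
  (expPartial-shift n n 0≤y)

-- Binomial coefficients

^-distribʳ-* : ∀ a b n → (a ℕ.* b) ℕ.^ n ≡ a ℕ.^ n ℕ.* b ℕ.^ n
^-distribʳ-* a b zero = refl
^-distribʳ-* a b (suc n) =
  trans (cong ((a ℕ.* b) ℕ.*_) (^-distribʳ-* a b n)) (ℕ-interchange a b (a ℕ.^ n) (b ℕ.^ n))

_choose_ : ℕ → ℕ → ℕ
n choose zero = 1
zero choose suc k = 0
suc n choose suc k = n choose suc k ℕ.+ n choose k

choose-absorb : ∀ n k → suc k ℕ.* (suc n choose suc k) ≡ suc n ℕ.* (n choose k)
choose-absorb zero zero = refl
choose-absorb zero (suc k) = ℕₚ.*-zeroʳ (suc (suc k))
choose-absorb (suc n) k = begin
  suc k ℕ.* (suc n choose suc k ℕ.+ suc n choose k)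
    ≡⟨ ℕₚ.*-distribˡ-+ (suc k) (suc n choose suc k) (suc n choose k) ⟩
  suc k ℕ.* (suc n choose suc k) ℕ.+ suc k ℕ.* (suc n choose k)
    ≡⟨ cong (ℕ._+ suc k ℕ.* (suc n choose k)) (choose-absorb n k) ⟩
  suc n ℕ.* (n choose k) ℕ.+ suc k ℕ.* (suc n choose k)
    ≡⟨ pascal k ⟩
  suc (suc n) ℕ.* (suc n choose k) ∎
  where
  open ≡-Reasoning
  pascal : ∀ k → suc n ℕ.* (n choose k) ℕ.+ suc k ℕ.* (suc n choose k) ≡ suc (suc n) ℕ.* (suc n choose k)
  pascal zero = identity n
    where
    identity : ∀ n → suc n ℕ.* 1 ℕ.+ 1 ℕ.* 1 ≡ suc (suc n) ℕ.* 1
    identity = ℕ-Solver.solve-∀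
  pascal (suc e) = begin
    suc n ℕ.* x ℕ.+ ((x ℕ.+ y) ℕ.+ suc e ℕ.* (x ℕ.+ y)) ≡⟨ cong (λ t → suc n ℕ.* x ℕ.+ ((x ℕ.+ y) ℕ.+ t))
                                                               (choose-absorb n e) ⟩
    suc n ℕ.* x ℕ.+ ((x ℕ.+ y) ℕ.+ suc n ℕ.* y)        ≡⟨ identity n x y ⟩
    suc (suc n) ℕ.* (x ℕ.+ y)                           ∎
    where
    x y : ℕ
    x = n choose suc e
    y = n choose e
    identity : ∀ n x y → suc n ℕ.* x ℕ.+ ((x ℕ.+ y) ℕ.+ suc n ℕ.* y) ≡ suc (suc n) ℕ.* (x ℕ.+ y)
    identity = ℕ-Solver.solve-∀

pow-ratio-≤ : ∀ {e n} → e ℕ.≤ n → e ℕ.^ e ℕ.* suc n ℕ.^ e ℕ.≤ suc e ℕ.^ e ℕ.* n ℕ.^ e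
pow-ratio-≤ {e} {n} e≤n = begin
  e ℕ.^ e ℕ.* suc n ℕ.^ e ≡⟨ ^-distribʳ-* e (suc n) e ⟨
  (e ℕ.* suc n) ℕ.^ e     ≤⟨ ℕₚ.^-monoˡ-≤ e ratio ⟩
  (suc e ℕ.* n) ℕ.^ e     ≡⟨ ^-distribʳ-* (suc e) n e ⟩
  suc e ℕ.^ e ℕ.* n ℕ.^ e ∎
  where
  open ℕₚ.≤-Reasoning
  ratio : e ℕ.* suc n ℕ.≤ suc e ℕ.* n
  ratio = begin
    e ℕ.* suc n       ≡⟨ ℕₚ.*-suc e n ⟩
    e ℕ.+ e ℕ.* n     ≤⟨ ℕₚ.+-monoˡ-≤ (e ℕ.* n) e≤n ⟩
    suc e ℕ.* n       ∎

choose-lower-bound : ∀ {n d} → d ℕ.≤ n → n ℕ.^ d ℕ.≤ d ℕ.^ d ℕ.* (n choose d)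
choose-lower-bound {d = zero} _ = ℕₚ.≤-refl
choose-lower-bound {suc n} {suc e} (s≤s e≤n) = begin
  suc n ℕ.* suc n ℕ.^ e                              ≤⟨ ℕₚ.*-monoʳ-≤ (suc n) (shifted e≤n) ⟩
  suc n ℕ.* (suc e ℕ.^ e ℕ.* (n choose e))           ≡⟨ ℕ-x∙yz≈y∙xz (suc n) (suc e ℕ.^ e) (n choose e) ⟩
  suc e ℕ.^ e ℕ.* (suc n ℕ.* (n choose e))           ≡⟨ cong (suc e ℕ.^ e ℕ.*_) (choose-absorb n e) ⟨
  suc e ℕ.^ e ℕ.* (suc e ℕ.* (suc n choose suc e))   ≡⟨ ℕ-x∙yz≈yx∙z (suc e ℕ.^ e) (suc e) (suc n choose suc e) ⟩
  suc e ℕ.^ suc e ℕ.* (suc n choose suc e)           ∎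
  where
  open ℕₚ.≤-Reasoning
  shifted : ∀ {e} → e ℕ.≤ n → suc n ℕ.^ e ℕ.≤ suc e ℕ.^ e ℕ.* (n choose e)
  shifted {zero} _ = ℕₚ.≤-refl
  shifted {e@(suc _)} e≤n = ℕₚ.*-cancelˡ-≤ (e ℕ.^ e) {{ℕₚ.m^n≢0 e e}} (begin
    e ℕ.^ e ℕ.* suc n ℕ.^ e                       ≤⟨ pow-ratio-≤ e≤n ⟩
    suc e ℕ.^ e ℕ.* n ℕ.^ e                       ≤⟨ ℕₚ.*-monoʳ-≤ (suc e ℕ.^ e) (choose-lower-bound e≤n) ⟩
    suc e ℕ.^ e ℕ.* (e ℕ.^ e ℕ.* (n choose e))    ≡⟨ ℕ-x∙yz≈y∙xz (suc e ℕ.^ e) (e ℕ.^ e) (n choose e) ⟩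
    e ℕ.^ e ℕ.* (suc e ℕ.^ e ℕ.* (n choose e))    ∎)

^-≤-choose : ∀ d n → 1 ℕ.≤ n → n ℕ.^ d ℕ.≤ (d ℕ.* n) choose d
^-≤-choose zero n _ = ℕₚ.≤-refl
^-≤-choose d@(suc _) n 1≤n = ℕₚ.*-cancelˡ-≤ (d ℕ.^ d) {{ℕₚ.m^n≢0 d d}} (begin
  d ℕ.^ d ℕ.* n ℕ.^ d            ≡⟨ ^-distribʳ-* d n d ⟨
  (d ℕ.* n) ℕ.^ d                ≤⟨ choose-lower-bound d≤d*n ⟩
  d ℕ.^ d ℕ.* ((d ℕ.* n) choose d) ∎)
  where
  open ℕₚ.≤-Reasoning
  d≤d*n : d ℕ.≤ d ℕ.* n
  d≤d*n = ℕₚ.≤-trans (ℕₚ.≤-reflexive (sym (ℕₚ.*-identityʳ d))) (ℕₚ.*-monoʳ-≤ d 1≤n)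

filter-map : ∀ {A B : Set} {P : Pred B 0ℓ} (P? : Decidable P) (f : A → B) xs →
  filter P? (map f xs) ≡ map f (filter (P? ∘ f) xs)
filter-map P? f [] = refl
filter-map P? f (x ∷ xs) with does (P? (f x))
... | true = cong (f x ∷_) (filter-map P? f xs)
... | false = filter-map P? f xs

length-filter-card : ∀ n d → length (filter (λ (S : Subset n) → card S ℕ.≟ d) (cube n)) ≡ n choose d
length-filter-card zero zero = refl
length-filter-card zero (suc d) = refl
length-filter-card (suc n) d = begin
  length (filter P? (map (false ∷_) (cube n) ++ map (true ∷_) (cube n)))
    ≡⟨ cong length (List.filter-++ P? (map (false ∷_) (cube n)) (map (true ∷_) (cube n))) ⟩
  length (filter P? (map (false ∷_) (cube n)) ++ filter P? (map (true ∷_) (cube n)))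
    ≡⟨ List.length-++ (filter P? (map (false ∷_) (cube n))) ⟩
  length (filter P? (map (false ∷_) (cube n))) ℕ.+ length (filter P? (map (true ∷_) (cube n)))
    ≡⟨ cong₂ ℕ._+_ (length-filter-prefix false) (length-filter-prefix true) ⟩
  length (filter (λ S → card S ℕ.≟ d) (cube n)) ℕ.+ length (filter (λ S → suc (card S) ℕ.≟ d) (cube n))
    ≡⟨ cong₂ ℕ._+_ (length-filter-card n d) (with-first-element d) ⟩
  n choose d ℕ.+ pred-choose d
    ≡⟨ pascal d ⟩
  suc n choose d ∎
  where
  open ≡-Reasoning
  P? : Decidable (λ (S : Subset (suc n)) → card S ≡ d)
  P? S = card S ℕ.≟ d
  length-filter-prefix : ∀ b → length (filter P? (map (b ∷_) (cube n))) ≡ length (filter (P? ∘ (b ∷_)) (cube n))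
  length-filter-prefix b = trans (cong length (filter-map P? (b ∷_) (cube n)))
    (List.length-map (b ∷_) (filter (P? ∘ (b ∷_)) (cube n)))
  pred-choose : ℕ → ℕ
  pred-choose zero = 0
  pred-choose (suc d) = n choose d
  with-first-element : ∀ d → length (filter (λ (S : Subset n) → suc (card S) ℕ.≟ d) (cube n)) ≡ pred-choose d
  with-first-element zero = cong length (List.filter-none _ (All.universal (λ _ ()) (cube n)))
  with-first-element (suc d) = trans
    (cong length (List.filter-≐ _ (λ S → card S ℕ.≟ d) (ℕₚ.suc-injective , cong suc) (cube n)))
    (length-filter-card n d)
  pascal : ∀ d → n choose d ℕ.+ pred-choose d ≡ suc n choose d
  pascal zero = refl
  pascal (suc d) = refl

-- Sums over the cube

sumℚ-++ : ∀ xs ys → sumℚ (xs ++ ys) ≡ sumℚ xs + sumℚ ys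
sumℚ-++ [] ys = sym (+-identityˡ (sumℚ ys))
sumℚ-++ (x ∷ xs) ys = trans (cong (x +_) (sumℚ-++ xs ys)) (sym (+-assoc x (sumℚ xs) (sumℚ ys)))

sumℚ-map-0 : ∀ {A : Set} (xs : List A) → sumℚ (map (λ _ → 0ℚ) xs) ≡ 0ℚ
sumℚ-map-0 [] = refl
sumℚ-map-0 (x ∷ xs) = trans (+-identityˡ _) (sumℚ-map-0 xs)

sumℚ-map-+ : ∀ {A : Set} (f g : A → ℚ) xs →
  sumℚ (map (λ x → f x + g x) xs) ≡ sumℚ (map f xs) + sumℚ (map g xs)
sumℚ-map-+ f g [] = refl
sumℚ-map-+ f g (x ∷ xs) = trans (cong (f x + g x +_) (sumℚ-map-+ f g xs))
  (interchange′ (f x) (g x) (sumℚ (map f xs)) (sumℚ (map g xs)))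
  where
  interchange′ : ∀ a b c d → (a + b) + (c + d) ≡ (a + c) + (b + d)
  interchange′ = solve-∀ ℚ-ring

sumℚ-map-neg : ∀ {A : Set} (f : A → ℚ) xs → sumℚ (map (λ x → - f x) xs) ≡ - sumℚ (map f xs)
sumℚ-map-neg f [] = refl
sumℚ-map-neg f (x ∷ xs) =
  trans (cong (- f x +_) (sumℚ-map-neg f xs)) (sym (neg-distrib-+ (f x) (sumℚ (map f xs))))

sumℚ-map-*ˡ : ∀ {A : Set} c (f : A → ℚ) xs → sumℚ (map (λ x → c * f x) xs) ≡ c * sumℚ (map f xs)
sumℚ-map-*ˡ c f [] = sym (*-zeroʳ c)
sumℚ-map-*ˡ c f (x ∷ xs) =
  trans (cong (c * f x +_) (sumℚ-map-*ˡ c f xs)) (sym (*-distribˡ-+ c (f x) (sumℚ (map f xs))))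

sumℚ-map-*ʳ : ∀ {A : Set} c (f : A → ℚ) xs → sumℚ (map (λ x → f x * c) xs) ≡ sumℚ (map f xs) * c
sumℚ-map-*ʳ c f [] = sym (*-zeroˡ c)
sumℚ-map-*ʳ c f (x ∷ xs) =
  trans (cong (f x * c +_) (sumℚ-map-*ʳ c f xs)) (sym (*-distribʳ-+ c (f x) (sumℚ (map f xs))))

sumℚ-lower-bound : ∀ {A : Set} {β} (h : A → ℚ) {xs} → All (λ x → β ≤ h x) xs →
  fromℕ (length xs) * β ≤ sumℚ (map h xs)
sumℚ-lower-bound {β = β} h [] = ≤-reflexive (*-zeroˡ β)
sumℚ-lower-bound {β = β} h {x ∷ xs} (β≤hx ∷ bounds) = begin
  (1ℚ + fromℕ (length xs)) * β      ≡⟨ *-distribʳ-+ β 1ℚ (fromℕ (length xs)) ⟩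
  1ℚ * β + fromℕ (length xs) * β    ≡⟨ cong (_+ fromℕ (length xs) * β) (*-identityˡ β) ⟩
  β + fromℕ (length xs) * β         ≤⟨ +-mono-≤ β≤hx (sumℚ-lower-bound h bounds) ⟩
  h x + sumℚ (map h xs)             ∎
  where open ≤-Reasoning

sumℚ-cube-suc : ∀ n (F : Vec Bool (suc n) → ℚ) →
  sumℚ (map F (cube (suc n))) ≡ sumℚ (map (F ∘ (false ∷_)) (cube n)) + sumℚ (map (F ∘ (true ∷_)) (cube n))
sumℚ-cube-suc n F = begin
  sumℚ (map F (map (false ∷_) (cube n) ++ map (true ∷_) (cube n)))
    ≡⟨ cong sumℚ (List.map-++ F (map (false ∷_) (cube n)) (map (true ∷_) (cube n))) ⟩
  sumℚ (map F (map (false ∷_) (cube n)) ++ map F (map (true ∷_) (cube n)))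
    ≡⟨ sumℚ-++ (map F (map (false ∷_) (cube n))) (map F (map (true ∷_) (cube n))) ⟩
  sumℚ (map F (map (false ∷_) (cube n))) + sumℚ (map F (map (true ∷_) (cube n)))
    ≡⟨ cong₂ (λ u v → sumℚ u + sumℚ v) (List.map-∘ (cube n)) (List.map-∘ (cube n)) ⟨
  sumℚ (map (F ∘ (false ∷_)) (cube n)) + sumℚ (map (F ∘ (true ∷_)) (cube n)) ∎
  where open ≡-Reasoning

sumℚ-cube-++ : ∀ a b (F : Vec Bool (a ℕ.+ b) → ℚ) →
  sumℚ (map F (cube (a ℕ.+ b))) ≡ sumℚ (map (λ y → sumℚ (map (λ z → F (y Vec.++ z)) (cube b))) (cube a))
sumℚ-cube-++ zero b F = sym (+-identityʳ _)
sumℚ-cube-++ (suc a) b F = begin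
  sumℚ (map F (cube (suc a ℕ.+ b)))
    ≡⟨ sumℚ-cube-suc (a ℕ.+ b) F ⟩
  sumℚ (map (F ∘ (false ∷_)) (cube (a ℕ.+ b))) + sumℚ (map (F ∘ (true ∷_)) (cube (a ℕ.+ b)))
    ≡⟨ cong₂ _+_ (sumℚ-cube-++ a b (F ∘ (false ∷_))) (sumℚ-cube-++ a b (F ∘ (true ∷_))) ⟩
  sumℚ (map (Σ₂ ∘ (false ∷_)) (cube a)) + sumℚ (map (Σ₂ ∘ (true ∷_)) (cube a))
    ≡⟨ sumℚ-cube-suc a Σ₂ ⟨
  sumℚ (map Σ₂ (cube (suc a))) ∎
  where
  open ≡-Reasoning
  Σ₂ : Vec Bool (suc a) → ℚ
  Σ₂ y = sumℚ (map (λ z → F (y Vec.++ z)) (cube b))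

-- Fourier coefficients of products on disjoint coordinates

card-++ : ∀ {a b} (u : Subset a) (v : Subset b) → card (u Vec.++ v) ≡ card u ℕ.+ card v
card-++ [] v = refl
card-++ (true ∷ u) v = cong suc (card-++ u v)
card-++ (false ∷ u) v = card-++ u v

χ-++ : ∀ {a b} (S₁ y : Subset a) (S₂ z : Subset b) → χ (S₁ Vec.++ S₂) (y Vec.++ z) ≡ χ S₁ y * χ S₂ z
χ-++ S₁ y S₂ z = begin
  negOnePow (card ((S₁ Vec.++ S₂) ∩ (y Vec.++ z)))      ≡⟨ cong (negOnePow ∘ card) (Vec.zipWith-++ _∧_ S₁ S₂ y z) ⟩
  negOnePow (card ((S₁ ∩ y) Vec.++ (S₂ ∩ z)))           ≡⟨ cong negOnePow (card-++ (S₁ ∩ y) (S₂ ∩ z)) ⟩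
  negOnePow (card (S₁ ∩ y) ℕ.+ card (S₂ ∩ z))           ≡⟨ negOnePow-+ (card (S₁ ∩ y)) (card (S₂ ∩ z)) ⟩
  χ S₁ y * χ S₂ z                                       ∎
  where open ≡-Reasoning

fourier-++ : ∀ a b {F : Vec Bool (a ℕ.+ b) → ℚ} {G H} → (∀ y z → F (y Vec.++ z) ≡ G y * H z) →
  ∀ S₁ S₂ → fourier (a ℕ.+ b) F (S₁ Vec.++ S₂) ≡ fourier a G S₁ * fourier b H S₂
fourier-++ a b {F} {G} {H} F≡G*H S₁ S₂ = begin
  halfPow (a ℕ.+ b) * sumℚ (map (λ x → F x * χ (S₁ Vec.++ S₂) x) (cube (a ℕ.+ b)))
    ≡⟨ cong₂ _*_ (halfPow-+ a b) (sumℚ-cube-++ a b (λ x → F x * χ (S₁ Vec.++ S₂) x)) ⟩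
  (halfPow a * halfPow b)
    * sumℚ (map (λ y → sumℚ (map (λ z → F (y Vec.++ z) * χ (S₁ Vec.++ S₂) (y Vec.++ z)) (cube b))) (cube a))
    ≡⟨ cong (λ t → (halfPow a * halfPow b) * sumℚ t)
         (List.map-cong (λ y → cong sumℚ (List.map-cong (factor y) (cube b))) (cube a)) ⟩
  (halfPow a * halfPow b) * sumℚ (map (λ y → sumℚ (map (λ z → g y * h z) (cube b))) (cube a))
    ≡⟨ cong (λ t → (halfPow a * halfPow b) * sumℚ t)
         (List.map-cong (λ y → sumℚ-map-*ˡ (g y) h (cube b)) (cube a)) ⟩
  (halfPow a * halfPow b) * sumℚ (map (λ y → g y * sumℚ (map h (cube b))) (cube a))
    ≡⟨ cong ((halfPow a * halfPow b) *_) (sumℚ-map-*ʳ (sumℚ (map h (cube b))) g (cube a)) ⟩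
  (halfPow a * halfPow b) * (sumℚ (map g (cube a)) * sumℚ (map h (cube b)))
    ≡⟨ interchange (halfPow a) (halfPow b) (sumℚ (map g (cube a))) (sumℚ (map h (cube b))) ⟩
  fourier a G S₁ * fourier b H S₂ ∎
  where
  open ≡-Reasoning
  g : Vec Bool a → ℚ
  g y = G y * χ S₁ y
  h : Vec Bool b → ℚ
  h z = H z * χ S₂ z
  factor : ∀ y z → F (y Vec.++ z) * χ (S₁ Vec.++ S₂) (y Vec.++ z) ≡ g y * h z
  factor y z = trans (cong₂ _*_ (F≡G*H y z) (χ-++ S₁ y S₂ z)) (interchange (G y) (H z) (χ S₁ y) (χ S₂ z))

FourierLowerBound : (n : ℕ) → (Vec Bool n → ℚ) → ℚ → ℚ → Set
FourierLowerBound n f α ρ = ∀ S → α * powℚ ρ (card S) ≤ ∣ fourier n f S ∣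

FourierLowerBound-++ : ∀ a b {F : Vec Bool (a ℕ.+ b) → ℚ} {G H α β ρ} →
  0ℚ ≤ α → 0ℚ ≤ β → 0ℚ ≤ ρ → (∀ y z → F (y Vec.++ z) ≡ G y * H z) →
  FourierLowerBound a G α ρ → FourierLowerBound b H β ρ → FourierLowerBound (a ℕ.+ b) F (α * β) ρ
FourierLowerBound-++ a b {F} {G} {H} {α} {β} {ρ} 0≤α 0≤β 0≤ρ F≡G*H boundG boundH S
  with S₁ , S₂ , refl ← Vec.splitAt a S = begin
  (α * β) * powℚ ρ (card (S₁ Vec.++ S₂))         ≡⟨ cong (λ c → (α * β) * powℚ ρ c) (card-++ S₁ S₂) ⟩
  (α * β) * powℚ ρ (c₁ ℕ.+ c₂)                   ≡⟨ cong ((α * β) *_) (powℚ-+ ρ c₁ c₂) ⟩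
  (α * β) * (powℚ ρ c₁ * powℚ ρ c₂)              ≡⟨ interchange α β (powℚ ρ c₁) (powℚ ρ c₂) ⟩
  (α * powℚ ρ c₁) * (β * powℚ ρ c₂)              ≤⟨ *-mono-≤-0≤ (*-nonNeg 0≤α (powℚ-nonNeg c₁ 0≤ρ))
                                                      (*-nonNeg 0≤β (powℚ-nonNeg c₂ 0≤ρ)) (boundG S₁) (boundH S₂) ⟩
  ∣ fourier a G S₁ ∣ * ∣ fourier b H S₂ ∣        ≡⟨ ∣p*q∣≡∣p∣*∣q∣ (fourier a G S₁) (fourier b H S₂) ⟨
  ∣ fourier a G S₁ * fourier b H S₂ ∣            ≡⟨ cong ∣_∣ (fourier-++ a b {F} {G} {H} F≡G*H S₁ S₂) ⟨
  ∣ fourier (a ℕ.+ b) F (S₁ Vec.++ S₂) ∣         ∎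
  where
  open ≤-Reasoning
  c₁ c₂ : ℕ
  c₁ = card S₁
  c₂ = card S₂

W1-lower-bound : ∀ n d {f α ρ} → FourierLowerBound n f α ρ → fromℕ (n choose d) * (α * powℚ ρ d) ≤ W1 n d f
W1-lower-bound n d {f} {α} {ρ} bound = subst (λ c → fromℕ c * (α * powℚ ρ d) ≤ W1 n d f)
  (length-filter-card n d)
  (sumℚ-lower-bound (λ S → ∣ fourier n f S ∣)
    (All.map (λ {S} ∣S∣≡d → subst (λ c → α * powℚ ρ c ≤ ∣ fourier n f S ∣) ∣S∣≡d (bound S))
             (all-filter (λ S → card S ℕ.≟ d) (cube n))))

-- The negated AND of m bits

allᵇ : ∀ {m} → (Fin m → Bool) → Bool
allᵇ {zero} _ = true
allᵇ {suc m} h = h zero ∧ allᵇ (h ∘ suc)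

notAll : ∀ m → Vec Bool m → ℚ
notAll m y = boolℚ (not (allᵇ (Vec.lookup y)))

sumℚ-allᵇ-* : ∀ m (h : Vec Bool m → ℚ) → sumℚ (map (λ y → boolℚ (allᵇ (Vec.lookup y)) * h y) (cube m)) ≡ h ⊤
sumℚ-allᵇ-* zero h = trans (+-identityʳ _) (*-identityˡ (h []))
sumℚ-allᵇ-* (suc m) h = begin
  sumℚ (map (λ y → boolℚ (allᵇ (Vec.lookup y)) * h y) (cube (suc m)))
    ≡⟨ sumℚ-cube-suc m (λ y → boolℚ (allᵇ (Vec.lookup y)) * h y) ⟩
  sumℚ (map (λ y → 0ℚ * h (false ∷ y)) (cube m))
    + sumℚ (map (λ y → boolℚ (allᵇ (Vec.lookup y)) * h (true ∷ y)) (cube m))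
    ≡⟨ cong₂ _+_ (trans (cong sumℚ (List.map-cong (λ y → *-zeroˡ (h (false ∷ y))) (cube m))) (sumℚ-map-0 (cube m)))
                 (sumℚ-allᵇ-* m (h ∘ (true ∷_))) ⟩
  0ℚ + h ⊤
    ≡⟨ +-identityˡ (h ⊤) ⟩
  h ⊤ ∎
  where open ≡-Reasoning

sumℚ-χ-nonempty : ∀ {m} (T : Subset m) → 1 ℕ.≤ card T → sumℚ (map (χ T) (cube m)) ≡ 0ℚ
sumℚ-χ-nonempty {suc m} (true ∷ T) _ = begin
  sumℚ (map (χ (true ∷ T)) (cube (suc m)))     ≡⟨ sumℚ-cube-suc m (χ (true ∷ T)) ⟩
  A + sumℚ (map (-_ ∘ χ T) (cube m))           ≡⟨ cong (A +_) (sumℚ-map-neg (χ T) (cube m)) ⟩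
  A - A                                        ≡⟨ +-inverseʳ A ⟩
  0ℚ                                           ∎
  where
  open ≡-Reasoning
  A : ℚ
  A = sumℚ (map (χ T) (cube m))
sumℚ-χ-nonempty {suc m} (false ∷ T) 1≤∣T∣ = trans (sumℚ-cube-suc m (χ (false ∷ T)))
  (trans (cong₂ _+_ (sumℚ-χ-nonempty T 1≤∣T∣) (sumℚ-χ-nonempty T 1≤∣T∣)) (+-identityʳ 0ℚ))

halfPow*sumℚ-χ-empty : ∀ {m} (T : Subset m) → card T ≡ 0 → halfPow m * sumℚ (map (χ T) (cube m)) ≡ 1ℚ
halfPow*sumℚ-χ-empty [] _ = refl
halfPow*sumℚ-χ-empty {suc m} (false ∷ T) ∣T∣≡0 = begin
  (½ * halfPow m) * sumℚ (map (χ (false ∷ T)) (cube (suc m)))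
    ≡⟨ cong ((½ * halfPow m) *_) (sumℚ-cube-suc m (χ (false ∷ T))) ⟩
  (½ * halfPow m) * (sumℚ (map (χ T) (cube m)) + sumℚ (map (χ T) (cube m)))
    ≡⟨ halve (halfPow m) (sumℚ (map (χ T) (cube m))) ⟩
  halfPow m * sumℚ (map (χ T) (cube m))
    ≡⟨ halfPow*sumℚ-χ-empty T ∣T∣≡0 ⟩
  1ℚ ∎
  where
  open ≡-Reasoning
  halve : ∀ h a → (½ * h) * (a + a) ≡ h * a
  halve = solve-∀ ℚ-ring
halfPow*sumℚ-χ-empty (true ∷ T) ()

boolℚ-not-* : ∀ b c → boolℚ (not b) * c ≡ c - boolℚ b * c
boolℚ-not-* true = solve-∀ ℚ-ring
boolℚ-not-* false = solve-∀ ℚ-ring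

fourier-notAll : ∀ m T → fourier m (notAll m) T ≡ halfPow m * (sumℚ (map (χ T) (cube m)) - negOnePow (card T))
fourier-notAll m T = cong (halfPow m *_) (begin
  sumℚ (map (λ y → notAll m y * χ T y) (cube m))
    ≡⟨ cong sumℚ (List.map-cong (λ y → boolℚ-not-* (allᵇ (Vec.lookup y)) (χ T y)) (cube m)) ⟩
  sumℚ (map (λ y → χ T y - 𝟙 y * χ T y) (cube m))
    ≡⟨ sumℚ-map-+ (χ T) (λ y → - (𝟙 y * χ T y)) (cube m) ⟩
  sumℚ (map (χ T) (cube m)) + sumℚ (map (λ y → - (𝟙 y * χ T y)) (cube m))
    ≡⟨ cong (sumℚ (map (χ T) (cube m)) +_)
         (trans (sumℚ-map-neg (λ y → 𝟙 y * χ T y) (cube m)) (cong -_ (sumℚ-allᵇ-* m (χ T)))) ⟩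
  sumℚ (map (χ T) (cube m)) - χ T ⊤
    ≡⟨ cong (λ S → sumℚ (map (χ T) (cube m)) - negOnePow (card S)) (∩-identityʳ T) ⟩
  sumℚ (map (χ T) (cube m)) - negOnePow (card T) ∎)
  where
  open ≡-Reasoning
  𝟙 : Vec Bool m → ℚ
  𝟙 y = boolℚ (allᵇ (Vec.lookup y))

fourier-notAll-∅ : ∀ m (T : Subset m) → card T ≡ 0 → fourier m (notAll m) T ≡ 1ℚ - halfPow m
fourier-notAll-∅ m T ∣T∣≡0 = begin
  fourier m (notAll m) T         ≡⟨ fourier-notAll m T ⟩
  q * (A - negOnePow (card T))   ≡⟨ cong (λ c → q * (A - negOnePow c)) ∣T∣≡0 ⟩
  q * (A - 1ℚ)                   ≡⟨ distrib q A ⟩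
  q * A - q                      ≡⟨ cong (_- q) (halfPow*sumℚ-χ-empty T ∣T∣≡0) ⟩
  1ℚ - q                         ∎
  where
  open ≡-Reasoning
  q A : ℚ
  q = halfPow m
  A = sumℚ (map (χ T) (cube m))
  distrib : ∀ q a → q * (a - 1ℚ) ≡ q * a - q
  distrib = solve-∀ ℚ-ring

∣fourier-notAll∣-nonempty : ∀ m (T : Subset m) → 1 ℕ.≤ card T → ∣ fourier m (notAll m) T ∣ ≡ halfPow m
∣fourier-notAll∣-nonempty m T 1≤∣T∣ = begin
  ∣ fourier m (notAll m) T ∣                ≡⟨ cong ∣_∣ (fourier-notAll m T) ⟩
  ∣ q * (sumℚ (map (χ T) (cube m)) - s) ∣   ≡⟨ cong (λ a → ∣ q * (a - s) ∣) (sumℚ-χ-nonempty T 1≤∣T∣) ⟩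
  ∣ q * (0ℚ - s) ∣                          ≡⟨ ∣p*q∣≡∣p∣*∣q∣ q (0ℚ - s) ⟩
  ∣ q ∣ * ∣ 0ℚ - s ∣                        ≡⟨ cong₂ _*_ (0≤p⇒∣p∣≡p (halfPow-nonNeg m))
                                                 (trans (cong ∣_∣ (+-identityˡ (- s))) (∣-p∣≡∣p∣ s)) ⟩
  q * ∣ s ∣                                 ≡⟨ cong (q *_) (∣negOnePow∣≡1 (card T)) ⟩
  q * 1ℚ                                    ≡⟨ *-identityʳ q ⟩
  q                                         ∎
  where
  open ≡-Reasoning
  q s : ℚ
  q = halfPow m
  s = negOnePow (card T)

notAll-lowerBound : ∀ m {ρ} → 0ℚ ≤ ρ → ρ ≤ 1ℚ → (1ℚ - halfPow m) * ρ ≡ halfPow m →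
  FourierLowerBound m (notAll m) (1ℚ - halfPow m) ρ
notAll-lowerBound m {ρ} 0≤ρ ρ≤1 r*ρ≡q T with card T in ∣T∣≡c
... | zero = begin
  r * 1ℚ                      ≡⟨ *-identityʳ r ⟩
  r                           ≡⟨ 0≤p⇒∣p∣≡p (1-halfPow-nonNeg m) ⟨
  ∣ r ∣                       ≡⟨ cong ∣_∣ (fourier-notAll-∅ m T ∣T∣≡c) ⟨
  ∣ fourier m (notAll m) T ∣  ∎
  where
  open ≤-Reasoning
  r : ℚ
  r = 1ℚ - halfPow m
... | suc c = begin
  r * (ρ * powℚ ρ c)          ≡⟨ *-assoc r ρ (powℚ ρ c) ⟨
  (r * ρ) * powℚ ρ c          ≡⟨ cong (_* powℚ ρ c) r*ρ≡q ⟩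
  q * powℚ ρ c                ≤⟨ *-monoˡ-≤-0≤ q (halfPow-nonNeg m)
                                   (≤-trans (powℚ-mono-≤ c 0≤ρ ρ≤1) (≤-reflexive (powℚ-1 c))) ⟩
  q * 1ℚ                      ≡⟨ *-identityʳ q ⟩
  q                           ≡⟨ ∣fourier-notAll∣-nonempty m T (subst (1 ℕ.≤_) (sym ∣T∣≡c) (s≤s z≤n)) ⟨
  ∣ fourier m (notAll m) T ∣  ∎
  where
  open ≤-Reasoning
  q r : ℚ
  q = halfPow m
  r = 1ℚ - q

-- Products over disjoint blocks

∈-++⁺ˡ : ∀ {a b} {u : Subset a} (v : Subset b) {x} → x ∈ u → x ↑ˡ b ∈ u Vec.++ v
∈-++⁺ˡ v here = here
∈-++⁺ˡ v (there x∈u) = there (∈-++⁺ˡ v x∈u)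

∈-++⁺ʳ : ∀ {a b} (u : Subset a) {v : Subset b} {x} → x ∈ v → a ↑ʳ x ∈ u Vec.++ v
∈-++⁺ʳ [] x∈v = x∈v
∈-++⁺ʳ (_ ∷ u) x∈v = there (∈-++⁺ʳ u x∈v)

Disjoint-++ : ∀ {a b} {u u′ : Subset a} {v v′ : Subset b} →
  Disjoint u u′ → Disjoint v v′ → Disjoint (u Vec.++ v) (u′ Vec.++ v′)
Disjoint-++ {u = []} {[]} _ v#v′ = v#v′
Disjoint-++ {u = _ ∷ _} {_ ∷ _} u#u′ v#v′ zero here here = u#u′ zero here here
Disjoint-++ {u = _ ∷ _} {_ ∷ _} u#u′ v#v′ (suc x) (there p) (there p′) =
  Disjoint-++ (λ y q q′ → u#u′ (suc y) (there q) (there q′)) v#v′ x p p′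

allᵇ-cong : ∀ {m} {h h′ : Fin m → Bool} → (∀ t → h t ≡ h′ t) → allᵇ h ≡ allᵇ h′
allᵇ-cong {zero} _ = refl
allᵇ-cong {suc m} h≗h′ = cong₂ _∧_ (h≗h′ zero) (allᵇ-cong (h≗h′ ∘ suc))

prodFin-cong : ∀ k {g g′ : Fin k → ℚ} → (∀ i → g i ≡ g′ i) → prodFin k g ≡ prodFin k g′
prodFin-cong zero _ = refl
prodFin-cong (suc k) g≗g′ = cong₂ _*_ (g≗g′ zero) (prodFin-cong k (g≗g′ ∘ suc))

module Blocks (m : ℕ) where

  block : ∀ k → Fin k → Subset (k ℕ.* m)
  block (suc k) zero = ⊤ {m} Vec.++ ⊥
  block (suc k) (suc i) = ⊥ {m} Vec.++ block k i

  combine∈block : ∀ k (i : Fin k) (t : Fin m) → combine i t ∈ block k i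
  combine∈block (suc k) zero t = ∈-++⁺ˡ ⊥ ∈⊤
  combine∈block (suc k) (suc i) t = ∈-++⁺ʳ ⊥ (combine∈block k i t)

  card-block : ∀ k (i : Fin k) → card (block k i) ≡ m
  card-block (suc k) zero = begin
    card (⊤ {m} Vec.++ ⊥ {k ℕ.* m})   ≡⟨ card-++ (⊤ {m}) (⊥ {k ℕ.* m}) ⟩
    card (⊤ {m}) ℕ.+ card (⊥ {k ℕ.* m}) ≡⟨ cong₂ ℕ._+_ (∣⊤∣≡n m) (∣⊥∣≡0 (k ℕ.* m)) ⟩
    m ℕ.+ 0                           ≡⟨ ℕₚ.+-identityʳ m ⟩
    m                                 ∎
    where open ≡-Reasoning
  card-block (suc k) (suc i) =
    trans (card-++ (⊥ {m}) (block k i)) (trans (cong (ℕ._+ card (block k i)) (∣⊥∣≡0 m)) (card-block k i))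

  block-disjoint : ∀ k (i j : Fin k) → i ≢ j → Disjoint (block k i) (block k j)
  block-disjoint (suc k) zero zero i≢j _ _ _ = i≢j refl
  block-disjoint (suc k) zero (suc j) _ = Disjoint-++ {m} (λ _ _ → ∉⊥) (λ _ x∈⊥ _ → ∉⊥ x∈⊥)
  block-disjoint (suc k) (suc i) zero _ = Disjoint-++ {m} (λ _ x∈⊥ _ → ∉⊥ x∈⊥) (λ _ _ → ∉⊥)
  block-disjoint (suc k) (suc i) (suc j) i≢j = Disjoint-++ {m} (λ _ _ → ∉⊥) (block-disjoint k i j (i≢j ∘ cong suc))

  blockFunction : ∀ k (i : Fin k) → Restr (block k i) → Bool
  blockFunction k i x = not (allᵇ (λ t → x (combine i t) (combine∈block k i t)))

  blockProduct : ∀ k → Vec Bool (k ℕ.* m) → ℚ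
  blockProduct k x = prodFin k (λ i → boolℚ (blockFunction k i (restrict x (block k i))))

  blockProduct-++ : ∀ k y z → blockProduct (suc k) (y Vec.++ z) ≡ notAll m y * blockProduct k z
  blockProduct-++ k y z = cong₂ _*_
    (cong (boolℚ ∘ not) (allᵇ-cong (Vec.lookup-++ˡ y z)))
    (prodFin-cong k (λ i → cong (boolℚ ∘ not) (allᵇ-cong (λ t → Vec.lookup-++ʳ y z (combine i t)))))

  blockProduct-lowerBound : ∀ k {ρ} → 0ℚ ≤ ρ → ρ ≤ 1ℚ → (1ℚ - halfPow m) * ρ ≡ halfPow m →
    FourierLowerBound (k ℕ.* m) (blockProduct k) (powℚ (1ℚ - halfPow m) k) ρ
  blockProduct-lowerBound zero _ _ _ [] = ≤-refl
  blockProduct-lowerBound (suc k) 0≤ρ ρ≤1 r*ρ≡q =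
    FourierLowerBound-++ m (k ℕ.* m) {blockProduct (suc k)} {notAll m} {blockProduct k}
    (1-halfPow-nonNeg m) (powℚ-nonNeg k (1-halfPow-nonNeg m)) 0≤ρ (blockProduct-++ k)
    (notAll-lowerBound m 0≤ρ ρ≤1 r*ρ≡q) (blockProduct-lowerBound k 0≤ρ ρ≤1 r*ρ≡q)

m^d≤choose*halfPow^d : ∀ m d → 1 ℕ.≤ m →
  powℚ (fromℕ m) d ≤ fromℕ ((d ℕ.* (2 ℕ.^ m ℕ.* m)) choose d) * powℚ (halfPow m) d
m^d≤choose*halfPow^d m d 1≤m = begin
  powℚ (fromℕ m) d                                    ≡⟨ *-identityˡ (powℚ (fromℕ m) d) ⟨
  1ℚ * powℚ (fromℕ m) d                               ≡⟨ cong (_* powℚ (fromℕ m) d) 1≡q^d*2^md ⟩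
  (powℚ q d * powℚ (fromℕ (2 ℕ.^ m)) d) * powℚ (fromℕ m) d
                                                      ≡⟨ *-assoc (powℚ q d) _ _ ⟩
  powℚ q d * (powℚ (fromℕ (2 ℕ.^ m)) d * powℚ (fromℕ m) d)
                                                      ≡⟨ cong (powℚ q d *_) (sym [2^m*m]^d) ⟩
  powℚ q d * fromℕ ((2 ℕ.^ m ℕ.* m) ℕ.^ d)            ≤⟨ *-monoˡ-≤-0≤ (powℚ q d) (powℚ-nonNeg d (halfPow-nonNeg m))
                                                           (fromℕ-mono-≤ (^-≤-choose d (2 ℕ.^ m ℕ.* m) 1≤2^m*m)) ⟩
  powℚ q d * fromℕ ((d ℕ.* (2 ℕ.^ m ℕ.* m)) choose d) ≡⟨ *-comm (powℚ q d) _ ⟩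
  fromℕ ((d ℕ.* (2 ℕ.^ m ℕ.* m)) choose d) * powℚ q d ∎
  where
  open ≤-Reasoning
  q : ℚ
  q = halfPow m
  1≡q^d*2^md : 1ℚ ≡ powℚ q d * powℚ (fromℕ (2 ℕ.^ m)) d
  1≡q^d*2^md = sym (trans (sym (powℚ-distribʳ-* q (fromℕ (2 ℕ.^ m)) d))
                   (trans (cong (λ x → powℚ x d) (halfPow*2^m≡1 m)) (powℚ-1 d)))
  [2^m*m]^d : fromℕ ((2 ℕ.^ m ℕ.* m) ℕ.^ d) ≡ powℚ (fromℕ (2 ℕ.^ m)) d * powℚ (fromℕ m) d
  [2^m*m]^d = trans (fromℕ-^ (2 ℕ.^ m ℕ.* m) d)
    (trans (cong (λ x → powℚ x d) (fromℕ-* (2 ℕ.^ m) m)) (powℚ-distribʳ-* (fromℕ (2 ℕ.^ m)) (fromℕ m) d))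
  1≤2^m*m : 1 ℕ.≤ 2 ℕ.^ m ℕ.* m
  1≤2^m*m = ℕₚ.*-mono-≤ (ℕₚ.m^n>0 2 m) 1≤m

2^suc≡2+ : ∀ m → ∃ λ M′ → 2 ℕ.^ suc m ≡ suc (suc M′)
2^suc≡2+ m with 2 ℕ.^ m | ℕₚ.m^n>0 2 m
... | suc t | _ = t ℕ.+ (t ℕ.+ 0) , cong suc (ℕₚ.+-suc t (t ℕ.+ 0))

module Construction (m′ d M′ : ℕ) (2^m≡2+M′ : 2 ℕ.^ suc m′ ≡ suc (suc M′)) where

  m M k : ℕ
  m = suc m′
  M = suc M′
  k = d ℕ.* 2 ℕ.^ m

  q r ρ : ℚ
  q = halfPow m
  r = 1ℚ - q
  ρ = ℤ.+ 1 / M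

  open Blocks m public

  W : ℚ
  W = W1 (k ℕ.* m) d (blockProduct k)

  0≤r : 0ℚ ≤ r
  0≤r = 1-halfPow-nonNeg m

  0≤ρ : 0ℚ ≤ ρ
  0≤ρ = nonNegative⁻¹ ρ {{normalize-nonNeg 1 M}}

  ρ*M≡1 : ρ * fromℕ M ≡ 1ℚ
  ρ*M≡1 = 1/n*n≡1 M

  ρ≤1 : ρ ≤ 1ℚ
  ρ≤1 = begin
    ρ               ≡⟨ *-identityʳ ρ ⟨
    ρ * 1ℚ          ≤⟨ *-monoˡ-≤-0≤ ρ 0≤ρ (fromℕ-mono-≤ (s≤s (z≤n {M′}))) ⟩
    ρ * fromℕ M     ≡⟨ ρ*M≡1 ⟩
    1ℚ              ∎
    where open ≤-Reasoning

  r*ρ≡q : r * ρ ≡ q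
  r*ρ≡q = begin
    (1ℚ - q) * ρ                     ≡⟨ cong (λ x → (x - q) * ρ) q*[1+M]≡1 ⟨
    (q * (1ℚ + fromℕ M) - q) * ρ     ≡⟨ identity q (fromℕ M) ρ ⟩
    q * (ρ * fromℕ M)                ≡⟨ cong (q *_) ρ*M≡1 ⟩
    q * 1ℚ                           ≡⟨ *-identityʳ q ⟩
    q                                ∎
    where
    open ≡-Reasoning
    q*[1+M]≡1 : q * fromℕ (suc M) ≡ 1ℚ
    q*[1+M]≡1 = trans (cong (λ n → q * fromℕ n) (sym 2^m≡2+M′)) (halfPow*2^m≡1 m)
    identity : ∀ q a ρ → (q * (1ℚ + a) - q) * ρ ≡ q * (ρ * a)
    identity = solve-∀ ℚ-ring

  r*[1+ρ]≡1 : r * (1ℚ + ρ) ≡ 1ℚ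
  r*[1+ρ]≡1 = begin
    (1ℚ - q) * (1ℚ + ρ)        ≡⟨ expand q ρ ⟩
    (1ℚ - q) + (1ℚ - q) * ρ    ≡⟨ cong ((1ℚ - q) +_) r*ρ≡q ⟩
    (1ℚ - q) + q               ≡⟨ cancel q ⟩
    1ℚ                         ∎
    where
    open ≡-Reasoning
    expand : ∀ q ρ → (1ℚ - q) * (1ℚ + ρ) ≡ (1ℚ - q) + (1ℚ - q) * ρ
    expand = solve-∀ ℚ-ring
    cancel : ∀ q → (1ℚ - q) + q ≡ 1ℚ
    cancel = solve-∀ ℚ-ring

  W-lower-bound : powℚ (fromℕ m) d * powℚ r (d ℕ.* M) ≤ W
  W-lower-bound = begin
    powℚ (fromℕ m) d * R                 ≤⟨ *-monoʳ-≤-0≤ R (powℚ-nonNeg (d ℕ.* M) 0≤r) (m^d≤choose*halfPow^d m d (s≤s z≤n)) ⟩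
    (fromℕ (N choose d) * powℚ q d) * R  ≡⟨ cong (λ n → (fromℕ (n choose d) * powℚ q d) * R) (ℕₚ.*-assoc d (2 ℕ.^ m) m) ⟨
    (fromℕ C * powℚ q d) * R             ≡⟨ *-assoc (fromℕ C) (powℚ q d) R ⟩
    fromℕ C * (powℚ q d * R)             ≡⟨ cong (fromℕ C *_) r^k*ρ^d ⟨
    fromℕ C * (powℚ r k * powℚ ρ d)      ≤⟨ W1-lower-bound (k ℕ.* m) d {f = blockProduct k} {α = powℚ r k}
                                              (blockProduct-lowerBound k 0≤ρ ρ≤1 r*ρ≡q) ⟩
    W                                    ∎
    where
    open ≤-Reasoning
    N C : ℕ
    N = d ℕ.* (2 ℕ.^ m ℕ.* m)
    C = (k ℕ.* m) choose d
    R : ℚ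
    R = powℚ r (d ℕ.* M)
    r^k*ρ^d : powℚ r k * powℚ ρ d ≡ powℚ q d * R
    r^k*ρ^d = begin-equality
      powℚ r k * powℚ ρ d                ≡⟨ cong (λ n → powℚ r n * powℚ ρ d)
                                              (trans (cong (d ℕ.*_) 2^m≡2+M′) (ℕₚ.*-suc d M)) ⟩
      powℚ r (d ℕ.+ d ℕ.* M) * powℚ ρ d  ≡⟨ cong (_* powℚ ρ d) (powℚ-+ r d (d ℕ.* M)) ⟩
      (powℚ r d * R) * powℚ ρ d          ≡⟨ xy∙z≈xz∙y (powℚ r d) R (powℚ ρ d) ⟩
      (powℚ r d * powℚ ρ d) * R          ≡⟨ cong (_* R) (powℚ-distribʳ-* r ρ d) ⟨
      powℚ (r * ρ) d * R                 ≡⟨ cong (λ x → powℚ x d * R) r*ρ≡q ⟩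
      powℚ q d * R                       ∎

  L : ℕ
  L = d ℕ.* M ℕ.+ d ℕ.* M

  E : ℚ
  E = expPartial (fromℕ (3 ℕ.* d)) (suc L)

  L*ρ≤3d : fromℕ L * ρ ≤ fromℕ (3 ℕ.* d)
  L*ρ≤3d = begin
    fromℕ (d ℕ.* M ℕ.+ d ℕ.* M) * ρ                  ≡⟨ cong (_* ρ) (fromℕ-+ (d ℕ.* M) (d ℕ.* M)) ⟩
    (fromℕ (d ℕ.* M) + fromℕ (d ℕ.* M)) * ρ          ≡⟨ *-distribʳ-+ ρ (fromℕ (d ℕ.* M)) (fromℕ (d ℕ.* M)) ⟩
    fromℕ (d ℕ.* M) * ρ + fromℕ (d ℕ.* M) * ρ        ≡⟨ cong (λ x → x + x) d*M*ρ≡d ⟩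
    fromℕ d + fromℕ d                                ≡⟨ fromℕ-+ d d ⟨
    fromℕ (d ℕ.+ d)                                  ≤⟨ fromℕ-mono-≤ (ℕₚ.+-monoʳ-≤ d (ℕₚ.m≤m+n d (d ℕ.+ 0))) ⟩
    fromℕ (3 ℕ.* d)                                  ∎
    where
    open ≤-Reasoning
    d*M*ρ≡d : fromℕ (d ℕ.* M) * ρ ≡ fromℕ d
    d*M*ρ≡d = begin-equality
      fromℕ (d ℕ.* M) * ρ         ≡⟨ cong (_* ρ) (fromℕ-* d M) ⟩
      (fromℕ d * fromℕ M) * ρ     ≡⟨ xy∙z≈x∙zy (fromℕ d) (fromℕ M) ρ ⟩
      fromℕ d * (ρ * fromℕ M)     ≡⟨ cong (fromℕ d *_) ρ*M≡1 ⟩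
      fromℕ d * 1ℚ                ≡⟨ *-identityʳ (fromℕ d) ⟩
      fromℕ d                     ∎

  -- r⁻¹ = 1 + ρ, so r^-L = (1 + ρ)^L ≤ e^(L ρ) = e^(2d) ≤ e^(3d)
  1≤r^2dM*E : 1ℚ ≤ (powℚ r (d ℕ.* M) * powℚ r (d ℕ.* M)) * E
  1≤r^2dM*E = begin
    1ℚ                              ≡⟨ powℚ-1 L ⟨
    powℚ 1ℚ L                       ≡⟨ cong (λ x → powℚ x L) r*[1+ρ]≡1 ⟨
    powℚ (r * (1ℚ + ρ)) L           ≡⟨ powℚ-distribʳ-* r (1ℚ + ρ) L ⟩
    powℚ r L * powℚ (1ℚ + ρ) L      ≤⟨ *-monoˡ-≤-0≤ (powℚ r L) (powℚ-nonNeg L 0≤r)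
                                         (≤-trans (1+y^n≤expPartial L 0≤ρ)
                                                  (expPartial-monoˡ-≤ (suc L) (*-nonNeg (fromℕ-nonNeg L) 0≤ρ) L*ρ≤3d)) ⟩
    powℚ r L * E                    ≡⟨ cong (_* E) (powℚ-+ r (d ℕ.* M) (d ℕ.* M)) ⟩
    (powℚ r (d ℕ.* M) * powℚ r (d ℕ.* M)) * E ∎
    where open ≤-Reasoning

  bound : BoundHolds m d W
  bound ε 0<ε rewrite ℕtoℚ≡fromℕ m | ℕtoℚ≡fromℕ (3 ℕ.* d) = suc L , (begin
    powℚ (fromℕ m) (d ℕ.+ (d ℕ.+ 0))     ≡⟨ powℚ-+ (fromℕ m) d (d ℕ.+ 0) ⟩
    a * powℚ (fromℕ m) (d ℕ.+ 0)         ≡⟨ cong (λ n → a * powℚ (fromℕ m) n) (ℕₚ.+-identityʳ d) ⟩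
    a * a                                ≡⟨ *-identityʳ (a * a) ⟨
    (a * a) * 1ℚ                         ≤⟨ *-monoˡ-≤-0≤ (a * a) (*-nonNeg 0≤a 0≤a) 1≤r^2dM*E ⟩
    (a * a) * ((R * R) * E)              ≡⟨ regroup a R E ⟩
    (a * R) * (a * R) * E                ≤⟨ *-monoʳ-≤-0≤ E (expPartial-nonNeg (suc L) (fromℕ-nonNeg (3 ℕ.* d)))
                                              (*-mono-≤-0≤ 0≤aR 0≤aR W-lower-bound W-lower-bound) ⟩
    W * W * E                            ≤⟨ p≤p+q (<⇒≤ 0<ε) ⟩
    W * W * E + ε                        ∎)
    where
    open ≤-Reasoning
    a R : ℚ
    a = powℚ (fromℕ m) d
    R = powℚ r (d ℕ.* M)
    0≤a : 0ℚ ≤ a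
    0≤a = powℚ-nonNeg d (fromℕ-nonNeg m)
    0≤aR : 0ℚ ≤ a * R
    0≤aR = *-nonNeg 0≤a (powℚ-nonNeg (d ℕ.* M) 0≤r)
    regroup : ∀ a R E → (a * a) * ((R * R) * E) ≡ (a * R) * (a * R) * E
    regroup = solve-∀ ℚ-ring

-- the statement of claim1p5 with the dimension n abstracted, so that blocks built in
-- dimension k * m can be transported along k * m ≡ m * k
Witnesses : (m d k n : ℕ) → Set
Witnesses m d k n =
  Σ (Fin k → Subset n) λ I →
    ((i j : Fin k) → i ≢ j → Disjoint (I i) (I j)) ×
    ((i : Fin k) → card (I i) ℕ.≤ m) ×
    Σ ((i : Fin k) → Restr (I i) → Bool) λ F →
      BoundHolds m d (W1 n d (λ x → prodFin k (λ i → boolℚ (F i (restrict x (I i))))))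

claim1p5 : (m d : ℕ) → 1 ℕ.≤ m → 1 ℕ.≤ d →
    Σ (Fin (d ℕ.* 2 ℕ.^ m) → Subset (m ℕ.* (d ℕ.* 2 ℕ.^ m))) λ I →
      ((i j : Fin (d ℕ.* 2 ℕ.^ m)) → i ≢ j → Disjoint (I i) (I j)) ×
      ((i : Fin (d ℕ.* 2 ℕ.^ m)) → card (I i) ℕ.≤ m) ×
      Σ ((i : Fin (d ℕ.* 2 ℕ.^ m)) → Restr (I i) → Bool) λ F →
        BoundHolds m d
          (W1 (m ℕ.* (d ℕ.* 2 ℕ.^ m)) d
            (λ x → prodFin (d ℕ.* 2 ℕ.^ m) (λ i → boolℚ (F i (restrict x (I i))))))
-- the argument needs no case distinction on d, so 1 ≤ d goes unused
claim1p5 (suc m′) d _ _ with M′ , 2^m≡2+M′ ← 2^suc≡2+ m′ =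
  subst (Witnesses m d k) (ℕₚ.*-comm k m)
    (block k , block-disjoint k , (λ i → ℕₚ.≤-reflexive (card-block k i)) , blockFunction k , bound)
  where open Construction m′ d M′ 2^m≡2+M′
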